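{- For even $n\ge2$ we have $\mathsf{D}_{\oplus}(\mathrm{THR}_n^2)=n$, and for odd $n\ge1$ we have $\mathsf{D}_{\oplus}(\mathrm{THR}_n^2)=n-1$.
   Context: $\mathrm{THR}_n^k\colon\{0,1\}^n\to\{ -1,1\}$ is defined by $\mathrm{THR}_n^k(x)=-1$ iff $\sum_{i=1}^n x_i\ge k$. A parity decision tree is a rooted binary tree whose internal nodes are labeled by parities $\bigoplus_{i\in S}x_i$, with two outgoing edges labeled by the possible parity values, and leaves labeled by $-1$ or $1$; $\mathsf{D}_{\oplus}(f)$ is the minimal depth of a parity decision tree computing $f$ (a constant function has $\mathsf{D}_{\oplus}=0$). -}

module Defs where

open import Data.Bool using (Bool; true; false; if_then_else_; _xor_)
open import Data.Nat using (ℕ; zero; suc; _+_; _≤_; _≥_; _≤ᵇ_; _⊔_)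
open import Data.Vec using (Vec; []; _∷_)
open import Data.Product using (Σ; _×_; _,_)
open import Relation.Binary.PropositionalEquality using (_≡_)

data Sign : Set where
  plus1 minus1 : Sign

weight : ∀ {n} → Vec Bool n → ℕ
weight [] = 0
weight (true ∷ xs) = suc (weight xs)
weight (false ∷ xs) = weight xs

THR : (n k : ℕ) → Vec Bool n → Sign
THR n k x = if k ≤ᵇ weight x then minus1 else plus1

-- A subset S ⊆ [n] as a characteristic vector; parity ⊕_{i∈S} x_i.
parity : ∀ {n} → Vec Bool n → Vec Bool n → Bool
parity [] [] = false
parity (s ∷ ss) (x ∷ xs) = (if s then x else false) xor parity ss xs

data PDT (n : ℕ) : Set where
  leaf : Sign → PDT n
  node : Vec Bool n → PDT n → PDT n → PDT n

eval : ∀ {n} → PDT n → Vec Bool n → Sign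
eval (leaf b) x = b
eval (node S t₀ t₁) x = if parity S x then eval t₁ x else eval t₀ x

depth : ∀ {n} → PDT n → ℕ
depth (leaf _) = 0
depth (node _ t₀ t₁) = suc (depth t₀ ⊔ depth t₁)

Computes : ∀ {n} → PDT n → (Vec Bool n → Sign) → Set
Computes T f = ∀ x → eval T x ≡ f x

D⊕≡ : ∀ {n} → (Vec Bool n → Sign) → ℕ → Set
D⊕≡ {n} f d = Σ (PDT n) (λ T → Computes T f × depth T ≡ d)
            × (∀ (T : PDT n) → Computes T f → d ≤ depth T)

-- A parity decision tree of depth d < n splits {0,1}ⁿ into affine subspaces of
-- codimension at most d, each of even size, so it outputs -1 on an even number of
-- inputs. THR_n^2 outputs -1 on 2ⁿ - n - 1 inputs, an odd number when n is even; so
-- D⊕(THR_n^2) = n for even n, and fixing x₁ = 0 gives D⊕(THR_n^2) ≥ n - 1 for odd n.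
-- For odd n the matching tree queries x₁ ⊕ x₂: if it is 1, the answer is whether the
-- remaining n - 2 bits are not all 0; if it is 0, querying x₁ either finishes or
-- leaves THR_{n-2}^2.
module Submission where

open import Defs
open import Data.Nat using (ℕ; suc; _*_; _≤_)
open import Data.Product using (_×_)

open import Algebra.Bundles using (CommutativeMonoid; CommutativeRing)
import Algebra.Properties.CommutativeSemigroup as CommutativeSemigroupProperties
open import Data.Bool using (Bool; true; false; not; _∧_; _xor_; if_then_else_)
open import Data.Bool.Properties
  using (xor-∧-commutativeRing; ∧-commutativeMonoid; xor-identityʳ; xor-same; xor-comm;
         ∧-zeroʳ; ∧-identityʳ)
open import Data.List using (List; []; _∷_; length)
open import Data.Nat using (zero; _+_; _<_; _⊔_; _≤ᵇ_; z≤n; s≤s; s≤s⁻¹)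
open import Data.Nat.Properties
  using (≤-refl; ≤-reflexive; ≤-antisym; <-≤-trans; ≤-<-trans; ≮⇒≥; +-suc; +-identityʳ; +-monoʳ-≤;
         m≤m⊔n; m≤n⊔m; ⊔-lub; ⊔-idem; *-suc)
open import Data.Product using (Σ; _,_)
open import Data.Vec using (Vec; []; _∷_; replicate; zipWith)
open import Function using (_∘_)
open import Relation.Binary.PropositionalEquality
open import Relation.Nullary using (contradiction)

open CommutativeSemigroupProperties (CommutativeRing.+-commutativeSemigroup xor-∧-commutativeRing)
  using () renaming (interchange to xor-interchange; x∙yz≈y∙xz to xor-leftSwap)
open CommutativeSemigroupProperties (CommutativeMonoid.commutativeSemigroup ∧-commutativeMonoid)
  using () renaming (x∙yz≈y∙xz to ∧-leftSwap)
open ≡-Reasoning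

oddCount : ∀ n → (Vec Bool n → Bool) → Bool
oddCount zero    f = f []
oddCount (suc n) f = oddCount n (λ xs → f (false ∷ xs)) xor oddCount n (λ xs → f (true ∷ xs))

oddCount-cong : ∀ n {f g : Vec Bool n → Bool} → (∀ x → f x ≡ g x) → oddCount n f ≡ oddCount n g
oddCount-cong zero    f≡g = f≡g []
oddCount-cong (suc n) f≡g =
  cong₂ _xor_ (oddCount-cong n (f≡g ∘ (false ∷_))) (oddCount-cong n (f≡g ∘ (true ∷_)))

oddCount-xor : ∀ n (f g : Vec Bool n → Bool) →
               oddCount n (λ x → f x xor g x) ≡ oddCount n f xor oddCount n g
oddCount-xor zero    f g = refl
oddCount-xor (suc n) f g =
  trans (cong₂ _xor_ (oddCount-xor n _ _) (oddCount-xor n _ _))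
        (xor-interchange (oddCount n (f ∘ (false ∷_))) (oddCount n (g ∘ (false ∷_)))
                         (oddCount n (f ∘ (true ∷_))) (oddCount n (g ∘ (true ∷_))))

oddCount-false : ∀ n → oddCount n (λ _ → false) ≡ false
oddCount-false zero    = refl
oddCount-false (suc n) rewrite oddCount-false n = refl

oddCount-ignoresHead : ∀ n {f : Vec Bool (suc n) → Bool} (g : Vec Bool n → Bool) →
                       (∀ a xs → f (a ∷ xs) ≡ g xs) → oddCount (suc n) f ≡ false
oddCount-ignoresHead n g f≡g =
  trans (cong₂ _xor_ (oddCount-cong n (f≡g false)) (oddCount-cong n (f≡g true)))
        (xor-same (oddCount n g))

oddCount-graph : ∀ n {f : Vec Bool (suc n) → Bool} (v g : Vec Bool n → Bool) →
                 (∀ a xs → f (a ∷ xs) ≡ not (a xor v xs) ∧ g xs) → oddCount (suc n) f ≡ oddCount n g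
oddCount-graph n {f} v g f≡ = begin
  oddCount n (f ∘ (false ∷_)) xor oddCount n (f ∘ (true ∷_))
    ≡⟨ cong₂ _xor_ (oddCount-cong n (f≡ false)) (oddCount-cong n (f≡ true)) ⟩
  oddCount n (λ xs → not (v xs) ∧ g xs) xor oddCount n (λ xs → not (not (v xs)) ∧ g xs)
    ≡⟨ sym (oddCount-xor n _ _) ⟩
  oddCount n (λ xs → (not (v xs) ∧ g xs) xor (not (not (v xs)) ∧ g xs))
    ≡⟨ oddCount-cong n (λ xs → select (v xs) (g xs)) ⟩
  oddCount n g ∎
  where
  select : ∀ b c → (not b ∧ c) xor (not (not b) ∧ c) ≡ c
  select false c = xor-identityʳ c
  select true  c = refl

Affine : ℕ → Set
Affine n = Vec Bool n × Bool

value : ∀ {n} → Affine n → Vec Bool n → Bool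
value (S , b) x = b xor parity S x

_+ᵃ_ : ∀ {n} → Affine n → Affine n → Affine n
(S , b) +ᵃ (S′ , b′) = zipWith _xor_ S S′ , b xor b′

System : ℕ → Set
System n = List (Affine n)

solves : ∀ {n} → System n → Vec Bool n → Bool
solves []      x = true
solves (ℓ ∷ C) x = not (value ℓ x) ∧ solves C x

parity-zipWith-xor : ∀ {n} (S S′ x : Vec Bool n) →
                     parity (zipWith _xor_ S S′) x ≡ parity S x xor parity S′ x
parity-zipWith-xor []      []        []       = refl
parity-zipWith-xor (s ∷ S) (s′ ∷ S′) (x ∷ xs) =
  trans (cong₂ _xor_ (select-xor s s′) (parity-zipWith-xor S S′ xs))
        (xor-interchange (if s then x else false) (if s′ then x else false)
                         (parity S xs) (parity S′ xs))
  where
  select-xor : ∀ s s′ → (if s xor s′ then x else false)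
                        ≡ (if s then x else false) xor (if s′ then x else false)
  select-xor false s′    = refl
  select-xor true  false = sym (xor-identityʳ x)
  select-xor true  true  = sym (xor-same x)

value-+ᵃ : ∀ {n} (ℓ ℓ′ : Affine n) x → value (ℓ +ᵃ ℓ′) x ≡ value ℓ x xor value ℓ′ x
value-+ᵃ (S , b) (S′ , b′) x =
  trans (cong ((b xor b′) xor_) (parity-zipWith-xor S S′ x))
        (xor-interchange b b′ (parity S x) (parity S′ x))

value-cons : ∀ {n} s (S : Vec Bool n) b a xs →
             value (s ∷ S , b) (a ∷ xs) ≡ (if s then a else false) xor value (S , b) xs
value-cons s S b a xs = xor-leftSwap b (if s then a else false) (parity S xs)

rowOperation : ∀ a u v r → not (a xor u) ∧ (not (a xor v) ∧ r)
                         ≡ not (a xor v) ∧ (not (u xor v) ∧ r)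
rowOperation false false false r = refl
rowOperation false false true  r = refl
rowOperation false true  false r = refl
rowOperation false true  true  r = refl
rowOperation true  false false r = refl
rowOperation true  false true  r = refl
rowOperation true  true  false r = refl
rowOperation true  true  true  r = refl

-- Gaussian elimination of the first variable.
data Elimination {n} (C : System (suc n)) : Set where
  free  : (R : System n) → length R ≤ length C →
          (∀ a xs → solves C (a ∷ xs) ≡ solves R xs) → Elimination C
  pivot : (ℓ : Affine n) (R : System n) → length R < length C →
          (∀ a xs → solves C (a ∷ xs) ≡ not (a xor value ℓ xs) ∧ solves R xs) → Elimination C

eliminate : ∀ {n} (C : System (suc n)) → Elimination C
eliminate [] = free [] z≤n (λ _ _ → refl)
eliminate ((false ∷ S , b) ∷ C) with eliminate C
... | free R shorter eq =
  free ((S , b) ∷ R) (s≤s shorter) (λ a xs → cong (not (value (S , b) xs) ∧_) (eq a xs))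
... | pivot ℓ R shorter eq =
  pivot ℓ ((S , b) ∷ R) (s≤s shorter) λ a xs →
    trans (cong (not (value (S , b) xs) ∧_) (eq a xs))
          (∧-leftSwap (not (value (S , b) xs)) (not (a xor value ℓ xs)) (solves R xs))
eliminate ((true ∷ S , b) ∷ C) with eliminate C
... | free R shorter eq =
  pivot (S , b) R (s≤s shorter) λ a xs →
    cong₂ _∧_ (cong not (value-cons true S b a xs)) (eq a xs)
... | pivot ℓ R shorter eq =
  pivot ℓ (((S , b) +ᵃ ℓ) ∷ R) (s≤s shorter) λ a xs → begin
    not (value (true ∷ S , b) (a ∷ xs)) ∧ solves C (a ∷ xs)
      ≡⟨ cong₂ _∧_ (cong not (value-cons true S b a xs)) (eq a xs) ⟩
    not (a xor value (S , b) xs) ∧ (not (a xor value ℓ xs) ∧ solves R xs)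
      ≡⟨ rowOperation a (value (S , b) xs) (value ℓ xs) (solves R xs) ⟩
    not (a xor value ℓ xs) ∧ (not (value (S , b) xs xor value ℓ xs) ∧ solves R xs)
      ≡⟨ cong (λ u → not (a xor value ℓ xs) ∧ (not u ∧ solves R xs)) (sym (value-+ᵃ (S , b) ℓ xs)) ⟩
    not (a xor value ℓ xs) ∧ solves (((S , b) +ᵃ ℓ) ∷ R) xs ∎

oddCount-solves : ∀ n (C : System n) → length C < n → oddCount n (solves C) ≡ false
oddCount-solves (suc n) C short with eliminate C
... | free R _ eq = oddCount-ignoresHead n {solves C} (solves R) eq
... | pivot ℓ R shorter eq =
  trans (oddCount-graph n {solves C} (value ℓ) (solves R) eq)
        (oddCount-solves n R (<-≤-trans shorter (s≤s⁻¹ short)))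

isMinus : Sign → Bool
isMinus plus1  = false
isMinus minus1 = true

D⊕≤ : ∀ {n} → (Vec Bool n → Sign) → ℕ → Set
D⊕≤ {n} f d = Σ (PDT n) λ T → Computes T f × depth T ≤ d

D⊕≥ : ∀ {n} → (Vec Bool n → Sign) → ℕ → Set
D⊕≥ {n} f d = ∀ (T : PDT n) → Computes T f → d ≤ depth T

D⊕≡-intro : ∀ {n} {f : Vec Bool n → Sign} {d} → D⊕≤ f d → D⊕≥ f d → D⊕≡ f d
D⊕≡-intro (T , computes , shallow) lower = (T , computes , ≤-antisym shallow (lower T computes)) , lower

-- The queries along a path of T, added to C, cut out the affine subspace of a leaf.
oddCount-eval : ∀ n (T : PDT n) (C : System n) → length C + depth T < n →
                oddCount n (λ x → solves C x ∧ isMinus (eval T x)) ≡ false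
oddCount-eval n (leaf plus1)  C _ =
  trans (oddCount-cong n (∧-zeroʳ ∘ solves C)) (oddCount-false n)
oddCount-eval n (leaf minus1) C short =
  trans (oddCount-cong n (∧-identityʳ ∘ solves C))
        (oddCount-solves n C (subst (_< n) (+-identityʳ (length C)) short))
oddCount-eval n (node S t₀ t₁) C short = begin
  oddCount n (λ x → solves C x ∧ isMinus (eval (node S t₀ t₁) x))
    ≡⟨ oddCount-cong n (λ x → split (parity S x) (solves C x) (eval t₀ x) (eval t₁ x)) ⟩
  oddCount n (λ x → (solves ((S , false) ∷ C) x ∧ isMinus (eval t₀ x))
                    xor (solves ((S , true) ∷ C) x ∧ isMinus (eval t₁ x)))
    ≡⟨ oddCount-xor n _ _ ⟩
  oddCount n (λ x → solves ((S , false) ∷ C) x ∧ isMinus (eval t₀ x))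
    xor oddCount n (λ x → solves ((S , true) ∷ C) x ∧ isMinus (eval t₁ x))
    ≡⟨ cong₂ _xor_ (oddCount-eval n t₀ ((S , false) ∷ C) (budget (m≤m⊔n (depth t₀) (depth t₁))))
                   (oddCount-eval n t₁ ((S , true) ∷ C) (budget (m≤n⊔m (depth t₀) (depth t₁)))) ⟩
  false ∎
  where
  split : ∀ p s (e₀ e₁ : Sign) → s ∧ isMinus (if p then e₁ else e₀)
          ≡ ((not p ∧ s) ∧ isMinus e₀) xor ((not (not p) ∧ s) ∧ isMinus e₁)
  split false s e₀ e₁ = sym (xor-identityʳ (s ∧ isMinus e₀))
  split true  s e₀ e₁ = refl

  budget : ∀ {d} → d ≤ depth t₀ ⊔ depth t₁ → suc (length C) + d < n
  budget d≤ = ≤-<-trans (s≤s (+-monoʳ-≤ (length C) d≤))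
                        (subst (_< n) (+-suc (length C) (depth t₀ ⊔ depth t₁)) short)

D⊕≥-oddCount : ∀ {n} (f : Vec Bool n → Sign) → oddCount n (isMinus ∘ f) ≡ true → D⊕≥ f n
D⊕≥-oddCount {n} f odd T computes = ≮⇒≥ λ shallow →
  contradiction (begin
    true                                ≡⟨ sym odd ⟩
    oddCount n (isMinus ∘ f)            ≡⟨ oddCount-cong n (cong isMinus ∘ sym ∘ computes) ⟩
    oddCount n (isMinus ∘ eval T)       ≡⟨ oddCount-eval n T [] shallow ⟩
    false                               ∎) λ ()

restrict : ∀ {n} → PDT (suc n) → PDT n
restrict (leaf b)             = leaf b
restrict (node (_ ∷ S) t₀ t₁) = node S (restrict t₀) (restrict t₁)

eval-restrict : ∀ {n} (T : PDT (suc n)) xs → eval (restrict T) xs ≡ eval T (false ∷ xs)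
eval-restrict (leaf b)             xs = refl
eval-restrict (node (false ∷ S) t₀ t₁) xs
  rewrite eval-restrict t₀ xs | eval-restrict t₁ xs = refl
eval-restrict (node (true ∷ S) t₀ t₁) xs
  rewrite eval-restrict t₀ xs | eval-restrict t₁ xs = refl

depth-restrict : ∀ {n} (T : PDT (suc n)) → depth (restrict T) ≡ depth T
depth-restrict (leaf b)             = refl
depth-restrict (node (_ ∷ S) t₀ t₁) rewrite depth-restrict t₀ | depth-restrict t₁ = refl

D⊕≥-restrict : ∀ {n d} {f : Vec Bool (suc n) → Sign} {g : Vec Bool n → Sign} →
               (∀ xs → f (false ∷ xs) ≡ g xs) → D⊕≥ g d → D⊕≥ f d
D⊕≥-restrict {d = d} f≡g lower T computes =
  subst (d ≤_) (depth-restrict T)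
        (lower (restrict T) λ xs → trans (eval-restrict T xs) (trans (computes (false ∷ xs)) (f≡g xs)))

weaken : ∀ {n} → PDT n → PDT (suc n)
weaken (leaf b)       = leaf b
weaken (node S t₀ t₁) = node (false ∷ S) (weaken t₀) (weaken t₁)

eval-weaken : ∀ {n} (T : PDT n) a xs → eval (weaken T) (a ∷ xs) ≡ eval T xs
eval-weaken (leaf b)       a xs = refl
eval-weaken (node S t₀ t₁) a xs rewrite eval-weaken t₀ a xs | eval-weaken t₁ a xs = refl

depth-weaken : ∀ {n} (T : PDT n) → depth (weaken T) ≡ depth T
depth-weaken (leaf b)       = refl
depth-weaken (node S t₀ t₁) rewrite depth-weaken t₀ | depth-weaken t₁ = refl

parity-zeros : ∀ n (x : Vec Bool n) → parity (replicate n false) x ≡ false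
parity-zeros zero    []       = refl
parity-zeros (suc n) (_ ∷ xs) = parity-zeros n xs

branch : ∀ {n} → PDT n → PDT n → PDT (suc n)
branch {n} t₀ t₁ = node (true ∷ replicate n false) (weaken t₀) (weaken t₁)

eval-branch : ∀ {n} (t₀ t₁ : PDT n) a xs →
              eval (branch t₀ t₁) (a ∷ xs) ≡ (if a then eval t₁ xs else eval t₀ xs)
eval-branch {n} t₀ t₁ a xs
  rewrite parity-zeros n xs | xor-identityʳ a | eval-weaken t₀ a xs | eval-weaken t₁ a xs = refl

depth-branch : ∀ {n} (t₀ t₁ : PDT n) → depth (branch t₀ t₁) ≡ suc (depth t₀ ⊔ depth t₁)
depth-branch t₀ t₁ rewrite depth-weaken t₀ | depth-weaken t₁ = refl

fullTree : ∀ n → (Vec Bool n → Sign) → PDT n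
fullTree zero    f = leaf (f [])
fullTree (suc n) f = branch (fullTree n (f ∘ (false ∷_))) (fullTree n (f ∘ (true ∷_)))

eval-fullTree : ∀ n f (x : Vec Bool n) → eval (fullTree n f) x ≡ f x
eval-fullTree zero    f []       = refl
eval-fullTree (suc n) f (a ∷ xs)
  rewrite eval-branch (fullTree n (f ∘ (false ∷_))) (fullTree n (f ∘ (true ∷_))) a xs
  with a
... | false = eval-fullTree n _ xs
... | true  = eval-fullTree n _ xs

depth-fullTree : ∀ n f → depth (fullTree n f) ≡ n
depth-fullTree zero    f = refl
depth-fullTree (suc n) f
  rewrite depth-branch (fullTree n (f ∘ (false ∷_))) (fullTree n (f ∘ (true ∷_)))
        | depth-fullTree n (f ∘ (false ∷_)) | depth-fullTree n (f ∘ (true ∷_)) = cong suc (⊔-idem n)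

D⊕≤-fullTree : ∀ {n} (f : Vec Bool n → Sign) → D⊕≤ f n
D⊕≤-fullTree {n} f = fullTree n f , eval-fullTree n f , ≤-reflexive (depth-fullTree n f)

THR-step : ∀ {n d} → D⊕≤ (THR n 2) d → n ≤ suc d → D⊕≤ (THR (2 + n) 2) (2 + d)
THR-step {n} {d} (T , computes , shallow) n≤1+d = tree , correct , bound
  where
  oneOfTwo : PDT n
  oneOfTwo = fullTree n (λ xs → THR (2 + n) 2 (true ∷ false ∷ xs))

  oneOfTwo-correct : ∀ a b xs →
                     eval (weaken (weaken oneOfTwo)) (a ∷ b ∷ xs) ≡ THR (2 + n) 2 (true ∷ false ∷ xs)
  oneOfTwo-correct a b xs
    rewrite eval-weaken (weaken oneOfTwo) a (b ∷ xs) | eval-weaken oneOfTwo b xs =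
    eval-fullTree n _ xs

  tree : PDT (2 + n)
  tree = node (true ∷ true ∷ replicate n false)
              (branch (weaken T) (leaf minus1)) (weaken (weaken oneOfTwo))

  correct : Computes tree (THR (2 + n) 2)
  correct (false ∷ false ∷ xs)
    rewrite parity-zeros n xs | eval-weaken (weaken T) false (false ∷ xs) | eval-weaken T false xs =
    computes xs
  correct (false ∷ true ∷ xs) rewrite parity-zeros n xs = oneOfTwo-correct false true xs
  correct (true ∷ false ∷ xs) rewrite parity-zeros n xs = oneOfTwo-correct true false xs
  correct (true ∷ true ∷ xs) rewrite parity-zeros n xs = refl

  bound : depth tree ≤ 2 + d
  bound rewrite depth-branch (weaken T) (leaf minus1) | depth-weaken T
              | depth-weaken (weaken oneOfTwo) | depth-weaken oneOfTwo
              | depth-fullTree n (λ xs → THR (2 + n) 2 (true ∷ false ∷ xs)) =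
    s≤s (⊔-lub (s≤s (⊔-lub shallow z≤n)) n≤1+d)

isMinus-THR : ∀ n k (x : Vec Bool n) → isMinus (THR n k x) ≡ (k ≤ᵇ weight x)
isMinus-THR n k x with k ≤ᵇ weight x
... | false = refl
... | true  = refl

oddCount-weight≥1 : ∀ n → oddCount (suc n) (λ x → 1 ≤ᵇ weight x) ≡ true
oddCount-weight≥1 zero    = refl
oddCount-weight≥1 (suc n)
  rewrite oddCount-weight≥1 n | oddCount-ignoresHead n {λ _ → true} (λ _ → true) (λ _ _ → refl) = refl

oddCount-weight≥2-step : ∀ n → oddCount (2 + n) (λ x → 2 ≤ᵇ weight x)
                               ≡ not (oddCount (suc n) (λ x → 2 ≤ᵇ weight x))
oddCount-weight≥2-step n rewrite oddCount-weight≥1 n =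
  xor-comm (oddCount (suc n) (λ x → 2 ≤ᵇ weight x)) true

oddCount-weight≥2-odd : ∀ m → oddCount (suc (2 * m)) (λ x → 2 ≤ᵇ weight x) ≡ false
oddCount-weight≥2-odd zero = refl
oddCount-weight≥2-odd (suc m) = begin
  oddCount (suc (2 * suc m)) (λ x → 2 ≤ᵇ weight x)
    ≡⟨ cong (λ k → oddCount (suc k) (λ x → 2 ≤ᵇ weight x)) (*-suc 2 m) ⟩
  oddCount (2 + suc (2 * m)) (λ x → 2 ≤ᵇ weight x)
    ≡⟨ oddCount-weight≥2-step (suc (2 * m)) ⟩
  not (oddCount (2 + 2 * m) (λ x → 2 ≤ᵇ weight x))
    ≡⟨ cong not (oddCount-weight≥2-step (2 * m)) ⟩
  not (not (oddCount (suc (2 * m)) (λ x → 2 ≤ᵇ weight x)))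
    ≡⟨ cong (not ∘ not) (oddCount-weight≥2-odd m) ⟩
  false ∎

oddCount-weight≥2-even : ∀ m → oddCount (2 * suc m) (λ x → 2 ≤ᵇ weight x) ≡ true
oddCount-weight≥2-even m = begin
  oddCount (2 * suc m) (λ x → 2 ≤ᵇ weight x)
    ≡⟨ cong (λ k → oddCount k (λ x → 2 ≤ᵇ weight x)) (*-suc 2 m) ⟩
  oddCount (2 + 2 * m) (λ x → 2 ≤ᵇ weight x)
    ≡⟨ oddCount-weight≥2-step (2 * m) ⟩
  not (oddCount (suc (2 * m)) (λ x → 2 ≤ᵇ weight x))
    ≡⟨ cong not (oddCount-weight≥2-odd m) ⟩
  true ∎

THR-even-lower : ∀ m → D⊕≥ (THR (2 * suc m) 2) (2 * suc m)
THR-even-lower m =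
  D⊕≥-oddCount (THR (2 * suc m) 2)
    (trans (oddCount-cong (2 * suc m) (isMinus-THR (2 * suc m) 2)) (oddCount-weight≥2-even m))

THR-odd-lower : ∀ m → D⊕≥ (THR (suc (2 * m)) 2) (2 * m)
THR-odd-lower zero    _ _ = z≤n
THR-odd-lower (suc m)     = D⊕≥-restrict (λ _ → refl) (THR-even-lower m)

THR-odd-upper : ∀ m → D⊕≤ (THR (suc (2 * m)) 2) (2 * m)
THR-odd-upper zero    = leaf plus1 , (λ { (false ∷ []) → refl ; (true ∷ []) → refl }) , z≤n
THR-odd-upper (suc m) =
  subst (λ k → D⊕≤ (THR (suc k) 2) k) (sym (*-suc 2 m)) (THR-step (THR-odd-upper m) ≤-refl)

lemma15 : (∀ (m : ℕ) → 1 ≤ m → D⊕≡ (THR (2 * m) 2) (2 * m))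
    × (∀ (m : ℕ) → D⊕≡ (THR (suc (2 * m)) 2) (2 * m))
lemma15 = even , odd
  where
  even : ∀ (m : ℕ) → 1 ≤ m → D⊕≡ (THR (2 * m) 2) (2 * m)
  even (suc m) _ = D⊕≡-intro (D⊕≤-fullTree (THR _ 2)) (THR-even-lower m)

  odd : ∀ (m : ℕ) → D⊕≡ (THR (suc (2 * m)) 2) (2 * m)
  odd m = D⊕≡-intro (THR-odd-upper m) (THR-odd-lower m)
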